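{- Let $\Sigma\subset\mathbb{N}$ be a finite alphabet, let $\varphi:\Sigma^*\to\Sigma^*$ be a Parikh-collinear morphism prolongable on a letter $a$, and let $\mathbf{x}=\varphi^\omega(a)$. Then the abelian complexity and the additive complexity of $\mathbf{x}$ are both bounded.
   Context: A morphism $\varphi:\Sigma^*\to\Sigma^*$ is Parikh-collinear if the Parikh vectors $\Psi(\varphi(b))=(|\varphi(b)|_c)_{c\in\Sigma}$, $b\in\Sigma$, are pairwise collinear (the matrix with these columns has rank at most 1). It is prolongable on $a$ if $\varphi(a)$ begins with $a$ and $|\varphi^n(a)|\to\infty$; then $\varphi^\omega(a)=\lim_n\varphi^n(a)$ is an infinite fixed point. Words $u,v$ are abelian equivalent if $|u|_c=|v|_c$ for all letters $c$, and additively equivalent if $|u|=|v|$ and $\sum_c c|u|_c=\sum_c c|v|_c$. The abelian (resp. additive) complexity of $\mathbf{x}$ maps $n$ to the number of abelian (resp. additive) equivalence classes of length-$n$ factors of $\mathbf{x}$. -}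

module Defs where

open import Data.Nat using (ℕ; zero; suc; _+_; _*_; _≤_; _<_)
open import Data.Fin using (Fin)
open import Data.Fin.Properties using (_≟_)
open import Data.List using (List; []; _∷_; length; filter; map; concatMap; lookup; upTo)
open import Data.Nat.ListAction using (sum)
open import Data.List.Membership.Propositional using (_∈_)
open import Data.Product using (Σ; ∃; _×_; _,_)
open import Relation.Binary.PropositionalEquality using (_≡_)
open import Function.Definitions using (Injective)

-- Alphabet: Σ = Fin k, embedded into ℕ by an injective labelling ν
-- (so Σ is a finite subset of ℕ with k elements).

Word : ℕ → Set
Word k = List (Fin k)

InfWord : ℕ → Set
InfWord k = ℕ → Fin k

Morphism : ℕ → Set
Morphism k = Fin k → Word k

apply : ∀ {k} → Morphism k → Word k → Word k
apply φ w = concatMap φ w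

iter : ∀ {k} → Morphism k → ℕ → Word k → Word k
iter φ zero    w = w
iter φ (suc n) w = apply φ (iter φ n w)

count : ∀ {k} → Fin k → Word k → ℕ
count c w = length (filter (_≟ c) w)

parikh : ∀ {k} → Word k → Fin k → ℕ
parikh w c = count c w

Collinear : ∀ {k} → (Fin k → ℕ) → (Fin k → ℕ) → Set
Collinear u v = ∀ c d → u c * v d ≡ u d * v c

ParikhCollinear : ∀ {k} → Morphism k → Set
ParikhCollinear φ = ∀ b b' → Collinear (parikh (φ b)) (parikh (φ b'))

Prolongable : ∀ {k} → Morphism k → Fin k → Set
Prolongable φ a =
  (Σ (Word _) λ u → φ a ≡ a ∷ u) ×
  (∀ N → Σ ℕ λ n → N ≤ length (iter φ n (a ∷ [])))

-- x = φ^ω(a): every φ^n(a) is a prefix of x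
IsFixedPointFrom : ∀ {k} → Morphism k → Fin k → InfWord k → Set
IsFixedPointFrom φ a x =
  ∀ n (i : Fin (length (iter φ n (a ∷ [])))) →
    x (Data.Fin.toℕ i) ≡ lookup (iter φ n (a ∷ [])) i

factor : ∀ {k} → InfWord k → ℕ → ℕ → Word k
factor x i n = map (λ j → x (i + j)) (upTo n)

AbelianEq : ∀ {k} → Word k → Word k → Set
AbelianEq u v = ∀ c → count c u ≡ count c v

weight : ∀ {k} → (Fin k → ℕ) → Word k → ℕ
weight ν w = sum (map ν w)

AdditiveEq : ∀ {k} → (Fin k → ℕ) → Word k → Word k → Set
AdditiveEq ν u v = length u ≡ length v × weight ν u ≡ weight ν v

-- The number of R-equivalence classes of length-n factors of x is at most B:
-- there are at most B words such that each length-n factor is R-equivalent to one of them.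
ClassesAtMost : ∀ {k} → (Word k → Word k → Set) → InfWord k → ℕ → ℕ → Set
ClassesAtMost R x n B =
  Σ (List (Word _)) λ reps → length reps ≤ B ×
    (∀ i → Σ (Word _) λ w → w ∈ reps × R (factor x i n) w)

BoundedComplexity : ∀ {k} → (Word k → Word k → Set) → InfWord k → Set
BoundedComplexity R x = Σ ℕ λ B → ∀ n → ClassesAtMost R x n B

{-# OPTIONS --safe #-}
module Submission where

-- Every factor of x = φ(x) lies inside some φ(W), hence has the form s φ(z) p with s and p
-- no longer than M = Σ_b |φ(b)|. Parikh-collinearity makes Ψ(φ(z)) the multiple of Ψ(φ(a))
-- determined by |φ(z)|, so the Parikh vector of a length-n factor is a function of n and the
-- short word sp. Hence at most as many abelian classes as words of length ≤ 2M occur for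
-- each n, and additive classes are unions of abelian ones.

open import Defs
open import Data.Nat using (ℕ; zero; suc; _+_; _*_; _∸_; _≤_; z≤n; s≤s; s≤s⁻¹; NonZero)
open import Data.Nat.Properties
  using (+-*-semiring; +-comm; +-assoc; +-identityʳ; *-identityˡ; *-identityʳ; *-zeroʳ; *-suc;
         *-distribʳ-+; ≤-trans; ≤-reflexive; ≤-total; n≤1+n; m≤m+n; +-mono-≤; m⊓n≤n; m∸n≤m;
         m≤n⇒m∸n≡0; m+n∸m≡n)
open import Data.Nat.DivMod using (_/_; m*n/n≡m)
open import Data.Nat.ListAction using (sum)
open import Data.Fin using (Fin; zero; suc; toℕ)
open import Data.Fin.Properties using (_≟_)
open import Data.List
  using (List; []; _∷_; _++_; length; filter; map; concat; lookup; upTo; applyUpTo; take; drop;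
         tabulate; replicate; allFin; cartesianProductWith)
open import Data.List.Properties
  using (length-++; length-map; length-upTo; map-upTo; filter-++; ++-assoc; ++-identityʳ;
         take-all; take-[]; drop-all; drop-[]; length-take; length-drop)
open import Data.List.Membership.Propositional using (_∈_)
open import Data.List.Membership.Propositional.Properties using (∈-map⁺; ∈-allFin; ∈-cartesianProductWith⁺)
open import Data.List.Relation.Unary.Any using (here; there)
open import Data.Product using (∃-syntax; _×_; _,_; proj₁; proj₂)
open import Data.Sum using (inj₁; inj₂)
open import Relation.Nullary using (yes; no)
open import Function using (_∘_)
open import Function.Definitions using (Injective)
open import Relation.Binary.PropositionalEquality using (_≡_; refl; sym; trans; cong; cong₂; subst)
open import Algebra.Properties.Semiring.Sum +-*-semiring
  using (sum-syntax; sum-cong-≗; sum-replicate-zero; sum-remove; ∑-distrib-+; *-distribˡ-sum; *-distribʳ-sum)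
open Relation.Binary.PropositionalEquality.≡-Reasoning

count-++ : ∀ {k} (c : Fin k) u v → count c (u ++ v) ≡ count c u + count c v
count-++ c u v = trans (cong length (filter-++ (_≟ c) u v)) (length-++ (filter (_≟ c) u))

additive-++-middle : ∀ {A : Set} (h : List A → ℕ) → (∀ u v → h (u ++ v) ≡ h u + h v) →
                     ∀ s m p → h (s ++ m ++ p) ≡ h (s ++ p) + h m
additive-++-middle h h-++ s m p = begin
  h (s ++ m ++ p)    ≡⟨ h-++ s (m ++ p) ⟩
  h s + h (m ++ p)   ≡⟨ cong (h s +_) (trans (h-++ m p) (+-comm (h m) (h p))) ⟩
  h s + (h p + h m)  ≡⟨ +-assoc (h s) (h p) (h m) ⟨
  h s + h p + h m    ≡⟨ cong (_+ h m) (h-++ s p) ⟨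
  h (s ++ p) + h m   ∎

count-suc-singleton : ∀ {k} (x c : Fin k) → count (suc c) (suc x ∷ []) ≡ count c (x ∷ [])
count-suc-singleton x c with x ≟ c
... | yes _ = refl
... | no _  = refl

∑-count-singletonˡ : ∀ {k} (x : Fin k) (g : Fin k → ℕ) → ∑[ c < k ] (count c (x ∷ []) * g c) ≡ g x
∑-count-singletonˡ {suc k} zero g =
  trans (cong₂ _+_ (*-identityˡ (g zero)) (sum-replicate-zero k)) (+-identityʳ (g zero))
∑-count-singletonˡ {suc k} (suc x) g =
  trans (sum-cong-≗ (λ c → cong (_* g (suc c)) (count-suc-singleton x c))) (∑-count-singletonˡ x (g ∘ suc))

∑-count-singletonʳ : ∀ {k} (x : Fin k) (g : Fin k → ℕ) → ∑[ d < k ] (count x (d ∷ []) * g d) ≡ g x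
∑-count-singletonʳ {suc k} zero g =
  trans (cong₂ _+_ (*-identityˡ (g zero)) (sum-replicate-zero k)) (+-identityʳ (g zero))
∑-count-singletonʳ {suc k} (suc x) g =
  trans (sum-cong-≗ (λ d → cong (_* g (suc d)) (count-suc-singleton d x))) (∑-count-singletonʳ x (g ∘ suc))

sum-map≡∑-count : ∀ {k} (g : Fin k → ℕ) (w : Word k) → sum (map g w) ≡ ∑[ c < k ] (count c w * g c)
sum-map≡∑-count {k} g []      = sym (sum-replicate-zero k)
sum-map≡∑-count {k} g (x ∷ w) = begin
  g x + sum (map g w)
    ≡⟨ cong₂ _+_ (∑-count-singletonˡ x g) (sym (sum-map≡∑-count g w)) ⟨
  ∑[ c < k ] (count c (x ∷ []) * g c) + ∑[ c < k ] (count c w * g c)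
    ≡⟨ ∑-distrib-+ (λ c → count c (x ∷ []) * g c) (λ c → count c w * g c) ⟨
  ∑[ c < k ] (count c (x ∷ []) * g c + count c w * g c)
    ≡⟨ sum-cong-≗ (λ c → trans (cong (_* g c) (count-++ c (x ∷ []) w))
                                (*-distribʳ-+ (g c) (count c (x ∷ [])) (count c w))) ⟨
  ∑[ c < k ] (count c (x ∷ w) * g c) ∎

∑-count≡length : ∀ {k} (w : Word k) → ∑[ c < k ] count c w ≡ length w
∑-count≡length {k} w = begin
  ∑[ c < k ] count c w          ≡⟨ sum-cong-≗ (λ c → *-identityʳ (count c w)) ⟨
  ∑[ c < k ] (count c w * 1)    ≡⟨ sum-map≡∑-count (λ _ → 1) w ⟨
  sum (map (λ _ → 1) w)         ≡⟨ sum-ones w ⟩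
  length w                      ∎
  where
  sum-ones : ∀ {A : Set} (xs : List A) → sum (map (λ _ → 1) xs) ≡ length xs
  sum-ones []       = refl
  sum-ones (_ ∷ xs) = cong suc (sum-ones xs)

AbelianEq⇒AdditiveEq : ∀ {k} (ν : Fin k → ℕ) (u v : Word k) → AbelianEq u v → AdditiveEq ν u v
AbelianEq⇒AdditiveEq ν u v u~v =
  trans (sym (∑-count≡length u)) (trans (sum-cong-≗ u~v) (∑-count≡length v)) ,
  trans (sum-map≡∑-count ν u) (trans (sum-cong-≗ (λ c → cong (_* ν c) (u~v c))) (sym (sum-map≡∑-count ν v)))

fromParikh : ∀ {k} → (Fin k → ℕ) → Word k
fromParikh f = concat (tabulate (λ d → replicate (f d) d))

count-replicate : ∀ {k} (c d : Fin k) m → count c (replicate m d) ≡ count c (d ∷ []) * m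
count-replicate c d zero    = sym (*-zeroʳ (count c (d ∷ [])))
count-replicate c d (suc m) =
  trans (count-++ c (d ∷ []) (replicate m d))
        (trans (cong (count c (d ∷ []) +_) (count-replicate c d m)) (sym (*-suc (count c (d ∷ [])) m)))

count-concat-tabulate : ∀ {k n} (c : Fin k) (ws : Fin n → Word k) →
                        count c (concat (tabulate ws)) ≡ ∑[ d < n ] count c (ws d)
count-concat-tabulate {n = zero}  c ws = refl
count-concat-tabulate {n = suc n} c ws =
  trans (count-++ c (ws zero) _) (cong (count c (ws zero) +_) (count-concat-tabulate c (ws ∘ suc)))

count-fromParikh : ∀ {k} (f : Fin k → ℕ) c → count c (fromParikh f) ≡ f c
count-fromParikh {k} f c = begin
  count c (fromParikh f)                  ≡⟨ count-concat-tabulate c (λ d → replicate (f d) d) ⟩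
  ∑[ d < k ] count c (replicate (f d) d)  ≡⟨ sum-cong-≗ (λ d → count-replicate c d (f d)) ⟩
  ∑[ d < k ] (count c (d ∷ []) * f d)     ≡⟨ ∑-count-singletonʳ c f ⟩
  f c                                     ∎

collinear-∑ : ∀ {k} {u v : Fin k → ℕ} → Collinear u v →
              ∀ c → u c * ∑[ d < k ] v d ≡ (∑[ d < k ] u d) * v c
collinear-∑ {k} {u} {v} u∥v c = begin
  u c * ∑[ d < k ] v d      ≡⟨ *-distribˡ-sum (u c) v ⟩
  ∑[ d < k ] (u c * v d)    ≡⟨ sum-cong-≗ (u∥v c) ⟩
  ∑[ d < k ] (u d * v c)    ≡⟨ *-distribʳ-sum (v c) u ⟨
  (∑[ d < k ] u d) * v c    ∎

module _ {k} {φ : Morphism k} (φ-collinear : ParikhCollinear φ) (a : Fin k) where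

  count-image-letter : ∀ b c → count c (φ b) * length (φ a) ≡ length (φ b) * count c (φ a)
  count-image-letter b c = begin
    count c (φ b) * length (φ a)                 ≡⟨ cong (count c (φ b) *_) (∑-count≡length (φ a)) ⟨
    count c (φ b) * ∑[ d < k ] count d (φ a)     ≡⟨ collinear-∑ (φ-collinear b a) c ⟩
    (∑[ d < k ] count d (φ b)) * count c (φ a)   ≡⟨ cong (_* count c (φ a)) (∑-count≡length (φ b)) ⟩
    length (φ b) * count c (φ a)                 ∎

  count-image : ∀ z c → count c (apply φ z) * length (φ a) ≡ length (apply φ z) * count c (φ a)
  count-image []      c = refl
  count-image (b ∷ z) c = begin
    count c (φ b ++ apply φ z) * L                     ≡⟨ cong (_* L) (count-++ c (φ b) (apply φ z)) ⟩
    (count c (φ b) + count c (apply φ z)) * L          ≡⟨ *-distribʳ-+ L (count c (φ b)) _ ⟩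
    count c (φ b) * L + count c (apply φ z) * L        ≡⟨ cong₂ _+_ (count-image-letter b c) (count-image z c) ⟩
    length (φ b) * V + length (apply φ z) * V          ≡⟨ *-distribʳ-+ V (length (φ b)) _ ⟨
    (length (φ b) + length (apply φ z)) * V            ≡⟨ cong (_* V) (length-++ (φ b)) ⟨
    length (φ b ++ apply φ z) * V                      ∎
    where
    L V : ℕ
    L = length (φ a)
    V = count c (φ a)

module _ {k} (φ : Morphism k) (a : Fin k) .{{_ : NonZero (length (φ a))}} where

  -- Since Ψ(φ(z)) = (|φ(z)| / |φ(a)|) Ψ(φ(a)), a word s φ(z) p of length n has
  -- Parikh vector Ψ(sp) + ((n - |sp|) / |φ(a)|) Ψ(φ(a)). The division is exact
  -- whenever t = sp comes from such a word; other codes give unused representatives.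
  parikhCode : ℕ → Word k → Fin k → ℕ
  parikhCode n t c = (count c t * length (φ a) + (n ∸ length t) * count c (φ a)) / length (φ a)

  count≡parikhCode : ParikhCollinear φ → ∀ s z p c →
                     count c (s ++ apply φ z ++ p) ≡ parikhCode (length (s ++ apply φ z ++ p)) (s ++ p) c
  count≡parikhCode φ-collinear s z p c = begin
    count c u              ≡⟨ m*n/n≡m (count c u) L ⟨
    count c u * L / L      ≡⟨ cong (_/ L) count×L ⟩
    parikhCode (length u) t c ∎
    where
    L V : ℕ
    L = length (φ a)
    V = count c (φ a)
    m u t : Word k
    m = apply φ z
    u = s ++ m ++ p
    t = s ++ p
    length-m : length u ∸ length t ≡ length m
    length-m = trans (cong (_∸ length t) (additive-++-middle length (λ v w → length-++ v) s m p))
                     (m+n∸m≡n (length t) (length m))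
    count×L : count c u * L ≡ count c t * L + (length u ∸ length t) * V
    count×L = begin
      count c u * L                   ≡⟨ cong (_* L) (additive-++-middle (count c) (count-++ c) s m p) ⟩
      (count c t + count c m) * L     ≡⟨ *-distribʳ-+ L (count c t) (count c m) ⟩
      count c t * L + count c m * L   ≡⟨ cong (count c t * L +_) (count-image φ-collinear a z c) ⟩
      count c t * L + length m * V    ≡⟨ cong (λ j → count c t * L + j * V) length-m ⟨
      count c t * L + (length u ∸ length t) * V ∎

take-++ : ∀ {A : Set} n (xs ys : List A) → take n (xs ++ ys) ≡ take n xs ++ take (n ∸ length xs) ys
take-++ zero    []       ys = refl
take-++ (suc n) []       ys = refl
take-++ zero    (x ∷ xs) ys = refl
take-++ (suc n) (x ∷ xs) ys = cong (x ∷_) (take-++ n xs ys)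

drop-++ : ∀ {A : Set} n (xs ys : List A) → drop n (xs ++ ys) ≡ drop n xs ++ drop (n ∸ length xs) ys
drop-++ zero    []       ys = refl
drop-++ (suc n) []       ys = refl
drop-++ zero    (x ∷ xs) ys = refl
drop-++ (suc n) (x ∷ xs) ys = drop-++ n xs ys

length-take≤ : ∀ {A : Set} n (xs : List A) → length (take n xs) ≤ length xs
length-take≤ n xs = ≤-trans (≤-reflexive (length-take n xs)) (m⊓n≤n n (length xs))

length-drop≤ : ∀ {A : Set} n (xs : List A) → length (drop n xs) ≤ length xs
length-drop≤ n xs = ≤-trans (≤-reflexive (length-drop n xs)) (m∸n≤m (length xs) n)

≤-∑ : ∀ {n} (f : Fin n → ℕ) i → f i ≤ ∑[ j < n ] f j
≤-∑ {suc n} f i = ≤-trans (m≤m+n (f i) _) (≤-reflexive (sym (sum-remove {i = i} f)))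

module _ {k} (φ : Morphism k) where

  totalLength : ℕ
  totalLength = ∑[ b < k ] length (φ b)

  drop-apply : ∀ i W → ∃[ s ] ∃[ z ] length s ≤ totalLength × drop i (apply φ W) ≡ s ++ apply φ z
  drop-apply i [] = [] , [] , z≤n , drop-[] i
  drop-apply i (b ∷ W) with ≤-total i (length (φ b))
  ... | inj₁ i≤ = drop i (φ b) , W , ≤-trans (length-drop≤ i (φ b)) (≤-∑ (length ∘ φ) b) ,
        trans (drop-++ i (φ b) (apply φ W)) (cong (λ j → drop i (φ b) ++ drop j (apply φ W)) (m≤n⇒m∸n≡0 i≤))
  ... | inj₂ ≥i with drop-apply (i ∸ length (φ b)) W
  ...   | s , z , s≤ , eq = s , z , s≤ , trans (drop-++ i (φ b) (apply φ W)) (cong₂ _++_ (drop-all i (φ b) ≥i) eq)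

  take-apply : ∀ n W → ∃[ z ] ∃[ p ] length p ≤ totalLength × take n (apply φ W) ≡ apply φ z ++ p
  take-apply n [] = [] , [] , z≤n , take-[] n
  take-apply n (b ∷ W) with ≤-total n (length (φ b))
  ... | inj₁ n≤ = [] , take n (φ b) , ≤-trans (length-take≤ n (φ b)) (≤-∑ (length ∘ φ) b) , (begin
        take n (φ b ++ apply φ W)                                ≡⟨ take-++ n (φ b) (apply φ W) ⟩
        take n (φ b) ++ take (n ∸ length (φ b)) (apply φ W)      ≡⟨ cong (λ j → take n (φ b) ++ take j (apply φ W)) (m≤n⇒m∸n≡0 n≤) ⟩
        take n (φ b) ++ []                                       ≡⟨ ++-identityʳ (take n (φ b)) ⟩
        take n (φ b)                                             ∎)
  ... | inj₂ ≥n with take-apply (n ∸ length (φ b)) W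
  ...   | z , p , p≤ , eq = b ∷ z , p , p≤ , (begin
        take n (φ b ++ apply φ W)                                ≡⟨ take-++ n (φ b) (apply φ W) ⟩
        take n (φ b) ++ take (n ∸ length (φ b)) (apply φ W)      ≡⟨ cong₂ _++_ (take-all n (φ b) ≥n) eq ⟩
        φ b ++ apply φ z ++ p                                    ≡⟨ ++-assoc (φ b) (apply φ z) p ⟨
        apply φ (b ∷ z) ++ p                                     ∎)

  take-drop-apply : ∀ i n W → ∃[ s ] ∃[ z ] ∃[ p ] length s ≤ totalLength × length p ≤ totalLength ×
                    take n (drop i (apply φ W)) ≡ s ++ apply φ z ++ p
  take-drop-apply i n W with drop-apply i W
  ... | s , z , s≤ , eq with take-apply (n ∸ length s) z
  ...   | z′ , p , p≤ , eq′ = take n s , z′ , p , ≤-trans (length-take≤ n s) s≤ , p≤ , (begin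
        take n (drop i (apply φ W))                    ≡⟨ cong (take n) eq ⟩
        take n (s ++ apply φ z)                        ≡⟨ take-++ n s (apply φ z) ⟩
        take n s ++ take (n ∸ length s) (apply φ z)    ≡⟨ cong (take n s ++_) eq′ ⟩
        take n s ++ apply φ z′ ++ p                    ∎)

applyUpTo-shift≡take-drop : ∀ {A : Set} (P : List A) (f : ℕ → A) → (∀ j → f (toℕ j) ≡ lookup P j) →
                            ∀ i n → i + n ≤ length P → applyUpTo (λ j → f (i + j)) n ≡ take n (drop i P)
applyUpTo-shift≡take-drop []      f f≡P zero    zero    _  = refl
applyUpTo-shift≡take-drop (y ∷ P) f f≡P zero    zero    _  = refl
applyUpTo-shift≡take-drop (y ∷ P) f f≡P zero    (suc n) le =
  cong₂ _∷_ (f≡P zero) (applyUpTo-shift≡take-drop P (f ∘ suc) (f≡P ∘ suc) 0 n (s≤s⁻¹ le))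
applyUpTo-shift≡take-drop (y ∷ P) f f≡P (suc i) n       le =
  applyUpTo-shift≡take-drop P (f ∘ suc) (f≡P ∘ suc) i n (s≤s⁻¹ le)

factor≡take-drop : ∀ {k} (x : InfWord k) (P : Word k) → (∀ j → x (toℕ j) ≡ lookup P j) →
                   ∀ i n → i + n ≤ length P → factor x i n ≡ take n (drop i P)
factor≡take-drop x P x≡P i n le = trans (map-upTo _ n) (applyUpTo-shift≡take-drop P x x≡P i n le)

length-factor : ∀ {k} (x : InfWord k) i n → length (factor x i n) ≡ n
length-factor x i n = trans (length-map _ (upTo n)) (length-upTo n)

factor-of-image : ∀ {k} {φ : Morphism k} {a : Fin k} {x : InfWord k} → Prolongable φ a → IsFixedPointFrom φ a x →
                  ∀ i n → ∃[ W ] factor x i n ≡ take n (drop i (apply φ W))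
factor-of-image {φ = φ} {a} {x} (_ , grows) fixed i n with grows (suc (i + n))
... | zero  , le = a ∷ [] , factor≡take-drop x _ (fixed 1) i n (≤-trans (s≤s⁻¹ le) z≤n)
... | suc N , le = iter φ N (a ∷ []) , factor≡take-drop x _ (fixed (suc N)) i n (≤-trans (n≤1+n _) le)

wordsUpTo : ∀ {k} → ℕ → List (Word k)
wordsUpTo     zero    = [] ∷ []
wordsUpTo {k} (suc N) = [] ∷ cartesianProductWith _∷_ (allFin k) (wordsUpTo N)

∈-wordsUpTo : ∀ {k} N (w : Word k) → length w ≤ N → w ∈ wordsUpTo N
∈-wordsUpTo zero    []      _         = here refl
∈-wordsUpTo (suc N) []      _         = here refl
∈-wordsUpTo (suc N) (c ∷ w) (s≤s w≤N) = there (∈-cartesianProductWith⁺ _∷_ (∈-allFin c) (∈-wordsUpTo N w w≤N))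

classesAtMost-byParikh : ∀ {k} {A : Set} (x : InfWord k) n (codes : List A) (ψ : A → Fin k → ℕ) →
                         (∀ i → ∃[ t ] t ∈ codes × ∀ c → count c (factor x i n) ≡ ψ t c) →
                         ClassesAtMost AbelianEq x n (length codes)
classesAtMost-byParikh x n codes ψ coded =
  map (fromParikh ∘ ψ) codes , ≤-reflexive (length-map _ codes) , λ i →
    let (t , t∈ , Ψ≡) = coded i
    in fromParikh (ψ t) , ∈-map⁺ (fromParikh ∘ ψ) t∈ , λ c → trans (Ψ≡ c) (sym (count-fromParikh (ψ t) c))

boundedComplexity-mono : ∀ {k} {R R′ : Word k → Word k → Set} {x : InfWord k} →
                         (∀ u v → R u v → R′ u v) → BoundedComplexity R x → BoundedComplexity R′ x
boundedComplexity-mono {x = x} R⇒R′ (B , classes) = B , λ n →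
  let (reps , reps≤B , cover) = classes n
  in reps , reps≤B , λ i → let (w , w∈ , r) = cover i in w , w∈ , R⇒R′ (factor x i n) w r

module _ {k} {φ : Morphism k} {a : Fin k} (φ-collinear : ParikhCollinear φ) (prolongable : Prolongable φ a)
         (x : InfWord k) (fixed : IsFixedPointFrom φ a x) where

  private
    M : ℕ
    M = totalLength φ

    instance
      length-φa≢0 : NonZero (length (φ a))
      length-φa≢0 = subst (NonZero ∘ length) (sym (proj₂ (proj₁ prolongable))) _

  factor-parikhCode : ∀ i n → ∃[ t ] length t ≤ M + M × ∀ c → count c (factor x i n) ≡ parikhCode φ a n t c
  factor-parikhCode i n with factor-of-image {x = x} prolongable fixed i n
  ... | W , u≡ with take-drop-apply φ i n W
  ...   | s , z , p , s≤ , p≤ , u≡′ = s ++ p , sp≤ , λ c → begin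
          count c (factor x i n)                                  ≡⟨ cong (count c) u≡szp ⟩
          count c (s ++ apply φ z ++ p)                           ≡⟨ count≡parikhCode φ a φ-collinear s z p c ⟩
          parikhCode φ a (length (s ++ apply φ z ++ p)) (s ++ p) c ≡⟨ cong (λ m → parikhCode φ a m (s ++ p) c) length≡n ⟩
          parikhCode φ a n (s ++ p) c                             ∎
    where
    u≡szp : factor x i n ≡ s ++ apply φ z ++ p
    u≡szp = trans u≡ u≡′
    length≡n : length (s ++ apply φ z ++ p) ≡ n
    length≡n = trans (cong length (sym u≡szp)) (length-factor x i n)
    sp≤ : length (s ++ p) ≤ M + M
    sp≤ = ≤-trans (≤-reflexive (length-++ s)) (+-mono-≤ s≤ p≤)

  abelianComplexity-bounded : BoundedComplexity AbelianEq x
  abelianComplexity-bounded = length codes , λ n → classesAtMost-byParikh x n codes (parikhCode φ a n) λ i →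
    let (t , t≤ , Ψ≡) = factor-parikhCode i n in t , ∈-wordsUpTo (M + M) t t≤ , Ψ≡
    where
    codes : List (Word k)
    codes = wordsUpTo (M + M)

corollary3p9 : (k : ℕ) (ν : Fin k → ℕ) → Injective _≡_ _≡_ ν →
    (φ : Morphism k) (a : Fin k) → ParikhCollinear φ → Prolongable φ a →
    (x : InfWord k) → IsFixedPointFrom φ a x →
    BoundedComplexity AbelianEq x × BoundedComplexity (AdditiveEq ν) x
corollary3p9 k ν _ φ a φ-collinear prolongable x fixed =
  abelian , boundedComplexity-mono {x = x} (AbelianEq⇒AdditiveEq ν) abelian
  where
  abelian : BoundedComplexity AbelianEq x
  abelian = abelianComplexity-bounded φ-collinear prolongable x fixed
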